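{- For all integers $n,k,\ell$ with $2\leq k<\ell\leq\lfloor n/2\rfloor$, there exists a graph $G$ of order $n$ such that $\gamma_{\times k,t}(G_I)=n(k+1)-2\ell$.
   Context: All graphs are finite, simple and undirected. For a graph $G$ without isolated vertices, the inflated graph $G_I$ is obtained as follows: each vertex $x_i$ of $G$ of degree $d(x_i)$ is replaced by a clique $X_i\cong K_{d(x_i)}$ whose vertices are labelled $x_ix_j$, one for each neighbour $x_j$ of $x_i$; and each edge $x_ix_j$ of $G$ is replaced by the edge joining $x_ix_j\in X_i$ to $x_jx_i\in X_j$. A set $S\subseteq V(H)$ is a $k$-tuple total dominating set of a graph $H$ if every vertex of $H$ has at least $k$ neighbours in $S$; $\gamma_{\times k,t}(H)$ denotes the minimum cardinality of such a set. -}

module Defs where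

open import Data.Nat using (ℕ; _≤_)
open import Data.Fin using (Fin)
open import Data.Fin.Properties using () renaming (_≟_ to _≟ᶠ_)
open import Data.Bool using (Bool; true; false; _∧_; _∨_; not; T)
open import Data.List using (List; length; filterᵇ; allFin; cartesianProduct)
open import Data.List.Membership.Propositional using (_∈_)
open import Data.Product using (_×_; _,_; proj₁; proj₂; Σ; ∃)
open import Relation.Nullary.Decidable using (⌊_⌋)
open import Relation.Binary.PropositionalEquality using (_≡_)

record Graph (n : ℕ) : Set where
  field
    adj    : Fin n → Fin n → Bool
    sym    : ∀ i j → adj i j ≡ adj j i
    irrefl : ∀ i → adj i i ≡ false

open Graph public

NoIsolated : ∀ {n} → Graph n → Set
NoIsolated {n} G = ∀ (i : Fin n) → ∃ λ (j : Fin n) → T (adj G i j)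

-- Vertices of the inflated graph G_I: the vertex x_i x_j of the clique X_i
-- is represented by the ordered pair (i , j) with x_i x_j an edge of G.
IVertex : ℕ → Set
IVertex n = Fin n × Fin n

isIVertex : ∀ {n} → Graph n → IVertex n → Bool
isIVertex G (i , j) = adj G i j

ivertices : ∀ {n} → Graph n → List (IVertex n)
ivertices {n} G = filterᵇ (isIVertex G) (cartesianProduct (allFin n) (allFin n))

_==_ : ∀ {n} → Fin n → Fin n → Bool
a == b = ⌊ a ≟ᶠ b ⌋

-- Adjacency in G_I: x_i x_j ~ x_i' x_j' iff they lie in the same clique
-- (i = i', j ≠ j') or they come from the same edge of G (i = j', j = i').
iadj : ∀ {n} → IVertex n → IVertex n → Bool
iadj (i , j) (i' , j') = ((i == i') ∧ not (j == j')) ∨ ((i == j') ∧ (j == i'))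

ISubset : ∀ {n} → Graph n → Set
ISubset {n} G = Σ (IVertex n → Bool) λ S → ∀ v → T (S v) → T (isIVertex G v)

card : ∀ {n} (G : Graph n) → ISubset G → ℕ
card G (S , _) = length (filterᵇ S (ivertices G))

nbrsIn : ∀ {n} (G : Graph n) → ISubset G → IVertex n → ℕ
nbrsIn G (S , _) u = length (filterᵇ (λ v → iadj u v ∧ S v) (ivertices G))

IsKTupleTDS : ∀ {n} (G : Graph n) → ℕ → ISubset G → Set
IsKTupleTDS G k S = ∀ u → u ∈ ivertices G → k ≤ nbrsIn G S u

GammaKT-Inflated≡ : ∀ {n} → Graph n → ℕ → ℕ → Set
GammaKT-Inflated≡ G k m =
  (Σ (ISubset G) λ S → IsKTupleTDS G k S × card G S ≡ m)
  × (∀ S → IsKTupleTDS G k S → m ≤ card G S)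

-- Theorem 4.5: for 2 ≤ k < ℓ ≤ ⌊n/2⌋ some graph G of order n without
-- isolated vertices has γ_{×k,t}(G_I) = n(k + 1) − 2ℓ; we take G = K_{ℓ,n−ℓ}.
--
-- For S ⊆ V(G_I) let deg i be the number of vertices of the clique X_i in S.
-- The vertex x_ix_j of G_I sees the rest of X_i and its partner x_jx_i, so
--   |N(x_ix_j) ∩ S| + [x_ix_j ∈ S] = deg i + [x_jx_i ∈ S]      (neighbours-in-S).
-- Consequently (k ≥ 2) S is a k-tuple total dominating set iff every
-- non-isolated x_i is served: deg i > k, or deg i ≥ k and every element of
-- S in X_i has its partner in S; a served x_i satisfies
-- k(k + 1) ≤ k·deg i + indeg i.  In K_{ℓ,m} summing deg ≥ k over side A and
-- this inequality over side B gives |S| ≥ (ℓ + m)(k + 1) − 2ℓ (lower-bound).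
-- A circulant k-regular pairing of A with ℓ vertices of B, plus k + 1
-- choices at each remaining B-vertex, attains the bound (Construction).
module Submission where

open import Defs hiding (sym)
open import Data.Bool using (Bool; true; false; _∧_; _∨_; not; T)
open import Data.Bool.Properties using (∧-zeroʳ)
open import Data.Empty using (⊥)
open import Data.Fin using (Fin; zero; suc; toℕ; _↑ˡ_; _↑ʳ_; fromℕ; fromℕ<; inject₁; splitAt; join)
open import Data.Fin.Properties
  using (splitAt-↑ˡ; splitAt-↑ʳ; join-splitAt; toℕ-injective; toℕ-fromℕ; toℕ-fromℕ<; toℕ-inject₁; toℕ<n)
  renaming (_≟_ to _≟ᶠ_; suc-injective to fsuc-injective)
open import Data.List using (List; _∷_; []; length; filterᵇ; allFin; tabulate; map; cartesianProduct; _++_)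
open import Data.List.Properties using (length-++; filter-++)
open import Data.List.Membership.Propositional using (_∈_)
open import Data.List.Membership.Propositional.Properties using (∈-filter⁺; ∈-filter⁻; ∈-cartesianProduct⁺; ∈-allFin)
open import Data.Nat using (ℕ; zero; suc; _+_; _*_; _∸_; _≤_; _<_; _<ᵇ_; z≤n; s≤s; NonZero; _%_)
open import Data.Nat.DivMod using (_/_; m/n*n≤m; m%n<n; m≤n⇒m%n≡m; m<n⇒m%n≡m; n%n≡0; m%n%n≡m%n; %-distribˡ-+)
open import Data.Nat.Properties
open import Data.Nat.Tactic.RingSolver using (solve-∀)
open import Data.Product using (Σ; _×_; _,_; proj₁; proj₂; ∃)
open import Data.Sum using (_⊎_; inj₁; inj₂; [_,_]; [_,_]′)
open import Data.Unit using (tt)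
open import Function using (_∘_)
open import Relation.Binary.PropositionalEquality
open import Relation.Nullary using (¬_; yes; no; contradiction)
open import Relation.Nullary.Decidable using (toWitness; T?)

open import Algebra.Properties.CommutativeMonoid.Sum +-0-commutativeMonoid
  using (sum; sum-cong-≗; sum-replicate-zero; sum-init-last; ∑-distrib-+; ∑-comm)

-- Finite sums and counting over Fin n

⟦_⟧ : Bool → ℕ
⟦ true ⟧  = 1
⟦ false ⟧ = 0

⟦⟧≤1 : ∀ b → ⟦ b ⟧ ≤ 1
⟦⟧≤1 true  = ≤-refl
⟦⟧≤1 false = z≤n

⟦T⟧ : ∀ {b} → T b → ⟦ b ⟧ ≡ 1
⟦T⟧ {true} _ = refl

⟦⟧-pos : ∀ {b} → 1 ≤ ⟦ b ⟧ → T b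
⟦⟧-pos {true} _ = tt

⟦⟧-mono : ∀ {a b} → (T a → T b) → ⟦ a ⟧ ≤ ⟦ b ⟧
⟦⟧-mono {false} _ = z≤n
⟦⟧-mono {true} {true} _ = ≤-refl
⟦⟧-mono {true} {false} a⇒b = contradiction (a⇒b tt) λ ()

count : ∀ {n} → (Fin n → Bool) → ℕ
count p = sum (λ x → ⟦ p x ⟧)

sum-zero : ∀ {n} (f : Fin n → ℕ) → (∀ x → f x ≡ 0) → sum f ≡ 0
sum-zero {n} f f≡0 = trans (sum-cong-≗ f≡0) (sum-replicate-zero n)

sum-const : ∀ {n} c → sum {n} (λ _ → c) ≡ n * c
sum-const {zero}  c = refl
sum-const {suc n} c = cong (c +_) (sum-const {n} c)

sum-*ˡ : ∀ {n} k (f : Fin n → ℕ) → sum (λ x → k * f x) ≡ k * sum f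
sum-*ˡ {zero}  k f = sym (*-zeroʳ k)
sum-*ˡ {suc n} k f =
  trans (cong (k * f zero +_) (sum-*ˡ k (f ∘ suc))) (sym (*-distribˡ-+ k (f zero) _))

sum-mono : ∀ {n} {f g : Fin n → ℕ} → (∀ x → f x ≤ g x) → sum f ≤ sum g
sum-mono {zero}  f≤g = z≤n
sum-mono {suc n} f≤g = +-mono-≤ (f≤g zero) (sum-mono (f≤g ∘ suc))

sum-↑ : ∀ {m n} (f : Fin (m + n) → ℕ) →
        sum f ≡ sum (λ a → f (a ↑ˡ n)) + sum (λ b → f (m ↑ʳ b))
sum-↑ {zero}  f = refl
sum-↑ {suc m} f = trans (cong (f zero +_) (sum-↑ {m} (f ∘ suc))) (sym (+-assoc (f zero) _ _))

↑-elim : ∀ {m n} (P : Fin (m + n) → Set) → (∀ a → P (a ↑ˡ n)) → (∀ b → P (m ↑ʳ b)) → ∀ i → P i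
↑-elim {m} {n} P onLeft onRight i =
  subst P (join-splitAt m n i) ([_,_] {C = P ∘ join m n} onLeft onRight (splitAt m i))

sum-point : ∀ {n} (a : Fin n) (f : Fin n → ℕ) → (∀ x → a ≢ x → f x ≡ 0) → sum f ≡ f a
sum-point zero    f f≡0 = trans (cong (f zero +_) (sum-zero (f ∘ suc) (λ x → f≡0 (suc x) λ ()))) (+-identityʳ _)
sum-point (suc a) f f≡0 =
  trans (cong (_+ sum (f ∘ suc)) (f≡0 zero λ ())) (sum-point a (f ∘ suc) (λ x a≢x → f≡0 (suc x) (a≢x ∘ fsuc-injective)))

count-mono : ∀ {n} {p q : Fin n → Bool} → (∀ x → T (p x) → T (q x)) → count p ≤ count q
count-mono p⇒q = sum-mono (λ x → ⟦⟧-mono (p⇒q x))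

count-witness : ∀ {n} (p : Fin n → Bool) → 0 < count p → ∃ λ x → T (p x)
count-witness {suc n} p 0<count with p zero in p₀
... | true  = zero , subst T (sym p₀) tt
... | false = let x , px = count-witness (p ∘ suc) 0<count in suc x , px

count-<ᵇ : ∀ n j → j ≤ n → count {n} (λ c → toℕ c <ᵇ j) ≡ j
count-<ᵇ n       zero    _         = sum-zero {n} (λ c → ⟦ toℕ c <ᵇ 0 ⟧) (λ _ → refl)
count-<ᵇ (suc n) (suc j) (s≤s j≤n) = cong suc (count-<ᵇ n j j≤n)

count₂ : ∀ {n} → (Fin n × Fin n → Bool) → ℕ
count₂ p = sum (λ i → count (λ j → p (i , j)))

count₂-exchange : ∀ {n} (p q r t : Fin n × Fin n → Bool) →
  (∀ v → ⟦ p v ⟧ + ⟦ q v ⟧ ≡ ⟦ r v ⟧ + ⟦ t v ⟧) → count₂ p + count₂ q ≡ count₂ r + count₂ t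
count₂-exchange p q r t exchange = begin
  count₂ p + count₂ q                                    ≡⟨ distrib p q ⟨
  sum (λ i → sum (λ j → ⟦ p (i , j) ⟧ + ⟦ q (i , j) ⟧))  ≡⟨ sum-cong-≗ (λ i → sum-cong-≗ (λ j → exchange (i , j))) ⟩
  sum (λ i → sum (λ j → ⟦ r (i , j) ⟧ + ⟦ t (i , j) ⟧))  ≡⟨ distrib r t ⟩
  count₂ r + count₂ t                                    ∎
  where
  open ≡-Reasoning
  distrib : ∀ p q → sum (λ i → sum (λ j → ⟦ p (i , j) ⟧ + ⟦ q (i , j) ⟧)) ≡ count₂ p + count₂ q
  distrib p q = trans (sum-cong-≗ (λ i → ∑-distrib-+ (λ j → ⟦ p (i , j) ⟧) (λ j → ⟦ q (i , j) ⟧)))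
                      (∑-distrib-+ (λ i → count (λ j → p (i , j))) (λ i → count (λ j → q (i , j))))

#filter : ∀ {A : Set} → (A → Bool) → List A → ℕ
#filter p xs = length (filterᵇ p xs)

#filter-++ : ∀ {A : Set} (p : A → Bool) xs ys → #filter p (xs ++ ys) ≡ #filter p xs + #filter p ys
#filter-++ p xs ys = trans (cong length (filter-++ _ xs ys)) (length-++ (filterᵇ p xs))

#filter-map : ∀ {A B : Set} (p : B → Bool) (f : A → B) xs → #filter p (map f xs) ≡ #filter (p ∘ f) xs
#filter-map p f []       = refl
#filter-map p f (x ∷ xs) with p (f x)
... | true  = cong suc (#filter-map p f xs)
... | false = #filter-map p f xs

#filter-filter : ∀ {A : Set} (p q : A → Bool) xs → #filter p (filterᵇ q xs) ≡ #filter (λ x → q x ∧ p x) xs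
#filter-filter p q []       = refl
#filter-filter p q (x ∷ xs) with q x
... | false = #filter-filter p q xs
... | true with p x
...   | true  = cong suc (#filter-filter p q xs)
...   | false = #filter-filter p q xs

#filter-tabulate : ∀ {A : Set} {n} (p : A → Bool) (f : Fin n → A) → #filter p (tabulate f) ≡ count (p ∘ f)
#filter-tabulate {n = zero}  p f = refl
#filter-tabulate {n = suc n} p f with p (f zero)
... | true  = cong suc (#filter-tabulate p (f ∘ suc))
... | false = #filter-tabulate p (f ∘ suc)

#filter-grid : ∀ {A : Set} {n} (p : A × A → Bool) (f : Fin n → A) (ys : List A) →
  #filter p (cartesianProduct (tabulate f) ys) ≡ sum (λ i → #filter (λ y → p (f i , y)) ys)
#filter-grid {n = zero}  p f ys = refl
#filter-grid {n = suc n} p f ys = trans (#filter-++ p (map (f zero ,_) ys) _)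
  (cong₂ _+_ (#filter-map p (f zero ,_) ys) (#filter-grid p (f ∘ suc) ys))

#filter-allPairs : ∀ {n} (p : Fin n × Fin n → Bool) →
  #filter p (cartesianProduct (allFin n) (allFin n)) ≡ count₂ p
#filter-allPairs {n} p =
  trans (#filter-grid p (λ i → i) (allFin n)) (sum-cong-≗ (λ i → #filter-tabulate (λ j → p (i , j)) (λ j → j)))

-- Counting in the inflated graph

==-refl : ∀ {n} (a : Fin n) → (a == a) ≡ true
==-refl a with a ≟ᶠ a
... | yes _   = refl
... | no a≢a = contradiction refl a≢a

==-≢ : ∀ {n} {a b : Fin n} → a ≢ b → (a == b) ≡ false
==-≢ {a = a} {b} a≢b with a ≟ᶠ b
... | yes a≡b = contradiction a≡b a≢b
... | no _    = refl

count-point : ∀ {n} (a : Fin n) (p : Fin n → Bool) → count (λ x → (a == x) ∧ p x) ≡ ⟦ p a ⟧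
count-point a p = trans (sum-point a (λ x → ⟦ (a == x) ∧ p x ⟧) (λ x a≢x → cong (λ b → ⟦ b ∧ p x ⟧) (==-≢ a≢x)))
                        (cong (λ b → ⟦ b ∧ p a ⟧) (==-refl a))

count₂-row : ∀ {n} (a : Fin n) (p : Fin n × Fin n → Bool) →
  count₂ (λ (i , j) → (a == i) ∧ p (i , j)) ≡ count (λ j → p (a , j))
count₂-row a p = trans
  (sum-point a (λ i → count (λ j → (a == i) ∧ p (i , j)))
    (λ i a≢i → sum-zero _ (λ j → cong (λ b → ⟦ b ∧ p (i , j) ⟧) (==-≢ a≢i))))
  (sum-cong-≗ (λ j → cong (λ b → ⟦ b ∧ p (a , j) ⟧) (==-refl a)))

count₂-point : ∀ {n} (a b : Fin n) (p : Fin n × Fin n → Bool) →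
  count₂ (λ (i , j) → (a == i) ∧ ((b == j) ∧ p (i , j))) ≡ ⟦ p (a , b) ⟧
count₂-point a b p = trans (count₂-row a (λ (i , j) → (b == j) ∧ p (i , j))) (count-point b (λ j → p (a , j)))

∧-absorbˡ : ∀ a b → (T b → T a) → a ∧ b ≡ b
∧-absorbˡ a     false _   = ∧-zeroʳ a
∧-absorbˡ true  true  _   = refl
∧-absorbˡ false true  b⇒a = contradiction (b⇒a tt) λ ()

#filter-ivertices : ∀ {n} (G : Graph n) (p : IVertex n → Bool) → (∀ v → T (p v) → T (isIVertex G v)) →
  #filter p (ivertices G) ≡ count₂ p
#filter-ivertices {n} G p p⊆V = begin
  #filter p (ivertices G)                                          ≡⟨ #filter-filter p (isIVertex G) (cartesianProduct (allFin n) (allFin n)) ⟩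
  #filter (λ v → isIVertex G v ∧ p v) (cartesianProduct (allFin n) (allFin n))
                                                                   ≡⟨ #filter-allPairs (λ v → isIVertex G v ∧ p v) ⟩
  count₂ (λ v → isIVertex G v ∧ p v)                               ≡⟨ sum-cong-≗ (λ i → sum-cong-≗ (λ j →
                                                                        cong ⟦_⟧ (∧-absorbˡ _ _ (p⊆V (i , j))))) ⟩
  count₂ p                                                         ∎
  where open ≡-Reasoning

adj⇒ivertex : ∀ {n} (G : Graph n) {i j} → T (adj G i j) → (i , j) ∈ ivertices G
adj⇒ivertex {n} G {i} {j} ij =
  ∈-filter⁺ (λ v → T? (isIVertex G v)) (∈-cartesianProduct⁺ (∈-allFin i) (∈-allFin j)) ij

ivertex⇒adj : ∀ {n} (G : Graph n) {i j} → (i , j) ∈ ivertices G → T (adj G i j)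
ivertex⇒adj {n} G mem = proj₂ (∈-filter⁻ (λ v → T? (isIVertex G v)) {xs = cartesianProduct (allFin n) (allFin n)} mem)

adj⇒≢ : ∀ {n} (G : Graph n) {i j} → T (adj G i j) → i ≢ j
adj⇒≢ G {i} ij refl = subst T (irrefl G i) ij

-- The Boolean content of adjacency in G_I, for a = (i == i'), b = (j == j'),
-- c = (i == j'), d = (j == i') with i ≢ j (which rules out a ∧ d and b ∧ c):
-- x_i'x_j' is a neighbour of x_ix_j or equal to it exactly when it lies in
-- the clique X_i or is the partner x_jx_i.
clique-identity : ∀ a b c d s → (T a → T d → ⊥) → (T b → T c → ⊥) →
  ⟦ ((a ∧ not b) ∨ (c ∧ d)) ∧ s ⟧ + ⟦ a ∧ (b ∧ s) ⟧ ≡ ⟦ a ∧ s ⟧ + ⟦ d ∧ (c ∧ s) ⟧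
clique-identity true  _     _     true  _ a∧d _   = contradiction tt (a∧d tt)
clique-identity _     true  true  _     _ _   b∧c = contradiction tt (b∧c tt)
clique-identity true  true  false false s _   _   = +-comm 0 ⟦ s ⟧
clique-identity true  false _     false s _   _   = refl
clique-identity false _     true  true  s _   _   = +-identityʳ ⟦ s ⟧
clique-identity false _     true  false s _   _   = refl
clique-identity false _     false true  s _   _   = refl
clique-identity false _     false false s _   _   = refl

module Degrees {n} (G : Graph n) (S : ISubset G) where

  ∈S : IVertex n → Bool
  ∈S = proj₁ S

  deg : Fin n → ℕ
  deg i = count (λ j → ∈S (i , j))

  indeg : Fin n → ℕ
  indeg i = count (λ j → ∈S (j , i))

  card≡∑deg : card G S ≡ sum deg
  card≡∑deg = #filter-ivertices G ∈S (proj₂ S)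

  -- Every vertex x_ix_j of G_I sees the other vertices of X_i and its
  -- partner x_jx_i, which gives the basic counting identity
  -- |N(x_ix_j) ∩ S| + [x_ix_j ∈ S] = deg i + [x_jx_i ∈ S].
  neighbours-in-S : ∀ i j → i ≢ j → nbrsIn G S (i , j) + ⟦ ∈S (i , j) ⟧ ≡ deg i + ⟦ ∈S (j , i) ⟧
  neighbours-in-S i j i≢j = begin
    nbrsIn G S (i , j) + ⟦ ∈S (i , j) ⟧
      ≡⟨ cong₂ _+_ (#filter-ivertices G N (λ v → proj₂ S v ∘ T-∧-right)) (sym (count₂-point i j ∈S)) ⟩
    count₂ N + count₂ (λ (i' , j') → (i == i') ∧ ((j == j') ∧ ∈S (i' , j')))
      ≡⟨ count₂-exchange N _ _ _ (λ (i' , j') → clique-identity (i == i') (j == j') (i == j') (j == i') (∈S (i' , j'))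
           (λ i≡i' j≡i' → i≢j (trans (toWitness i≡i') (sym (toWitness j≡i'))))
           (λ j≡j' i≡j' → i≢j (trans (toWitness i≡j') (sym (toWitness j≡j'))))) ⟩
    count₂ (λ (i' , j') → (i == i') ∧ ∈S (i' , j')) + count₂ (λ (i' , j') → (j == i') ∧ ((i == j') ∧ ∈S (i' , j')))
      ≡⟨ cong₂ _+_ (count₂-row i ∈S) (count₂-point j i ∈S) ⟩
    deg i + ⟦ ∈S (j , i) ⟧ ∎
    where
    open ≡-Reasoning
    N : IVertex n → Bool
    N v = iadj (i , j) v ∧ ∈S v
    T-∧-right : ∀ {a b} → T (a ∧ b) → T b
    T-∧-right {true} t = t

module Domination {n} (G : Graph n) (S : ISubset G) (k : ℕ) where
  open Degrees G S

  -- The domination requirement at the vertex x_ix_j, via neighbours-in-S.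
  LocallyDominated : Fin n → Fin n → Set
  LocallyDominated i j = k + ⟦ ∈S (i , j) ⟧ ≤ deg i + ⟦ ∈S (j , i) ⟧

  tds⇒local : IsKTupleTDS G k S → ∀ {i j} → T (adj G i j) → LocallyDominated i j
  tds⇒local tds {i} {j} ij = subst (k + ⟦ ∈S (i , j) ⟧ ≤_) (neighbours-in-S i j (adj⇒≢ G ij))
                               (+-monoˡ-≤ ⟦ ∈S (i , j) ⟧ (tds (i , j) (adj⇒ivertex G ij)))

  local⇒tds : (∀ {i j} → T (adj G i j) → LocallyDominated i j) → IsKTupleTDS G k S
  local⇒tds local (i , j) mem = +-cancelʳ-≤ ⟦ ∈S (i , j) ⟧ k (nbrsIn G S (i , j))
    (subst (k + ⟦ ∈S (i , j) ⟧ ≤_) (sym (neighbours-in-S i j (adj⇒≢ G ij))) (local ij))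
    where
    ij : T (adj G i j)
    ij = ivertex⇒adj G mem

  Reciprocated : Fin n → Set
  Reciprocated i = ∀ j → T (∈S (i , j)) → T (∈S (j , i))

  Served : Fin n → Set
  Served i = k < deg i ⊎ (k ≤ deg i × Reciprocated i)

  served⇒local : ∀ {i} → Served i → ∀ j → LocallyDominated i j
  served⇒local {i} (inj₁ k<deg) j = begin
    k + ⟦ ∈S (i , j) ⟧  ≤⟨ +-monoʳ-≤ k (⟦⟧≤1 (∈S (i , j))) ⟩
    k + 1               ≡⟨ +-comm k 1 ⟩
    suc k               ≤⟨ k<deg ⟩
    deg i               ≤⟨ m≤m+n (deg i) _ ⟩
    deg i + ⟦ ∈S (j , i) ⟧ ∎
    where open ≤-Reasoning
  served⇒local (inj₂ (k≤deg , reciprocated)) j = +-mono-≤ k≤deg (⟦⟧-mono (reciprocated j))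

  served⇒tds : (∀ i → Served i) → IsKTupleTDS G k S
  served⇒tds served = local⇒tds (λ {i} {j} _ → served⇒local (served i) j)

  served⇒k≤deg : ∀ {i} → Served i → k ≤ deg i
  served⇒k≤deg (inj₁ k<deg)       = <⇒≤ k<deg
  served⇒k≤deg (inj₂ (k≤deg , _)) = k≤deg

  -- A served vertex satisfies k(k+1) ≤ k·deg i + indeg i: either deg i > k,
  -- or deg i ≥ k and reciprocity gives indeg i ≥ deg i ≥ k.
  served⇒bound : ∀ {i} → Served i → k * suc k ≤ k * deg i + indeg i
  served⇒bound {i} (inj₁ k<deg) = ≤-trans (*-monoʳ-≤ k k<deg) (m≤m+n (k * deg i) (indeg i))
  served⇒bound {i} (inj₂ (k≤deg , reciprocated)) = begin
    k * suc k            ≡⟨ *-suc k k ⟩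
    k + k * k            ≤⟨ +-mono-≤ (≤-trans k≤deg (count-mono reciprocated)) (*-monoʳ-≤ k k≤deg) ⟩
    indeg i + k * deg i  ≡⟨ +-comm (indeg i) (k * deg i) ⟩
    k * deg i + indeg i  ∎
    where open ≤-Reasoning

  module _ (tds : IsKTupleTDS G k S) where

    dominated-member : ∀ {i j} → T (∈S (i , j)) → k + 1 ≤ deg i + ⟦ ∈S (j , i) ⟧
    dominated-member {i} {j} i,j∈S =
      subst (λ b → k + b ≤ deg i + ⟦ ∈S (j , i) ⟧) (⟦T⟧ i,j∈S) (tds⇒local tds (proj₂ S (i , j) i,j∈S))

    -- For k ≥ 2 every non-isolated x_i is served: X_i meets S (else a
    -- vertex of X_i would see at most one element of S), hence holds at
    -- least k elements of S, and if it holds only k they are reciprocated.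
    tds⇒served : 1 < k → ∀ {i j} → T (adj G i j) → Served i
    tds⇒served 1<k {i} {j} ij with k <? deg i
    ... | yes k<deg = inj₁ k<deg
    ... | no  k≮deg = inj₂ (k≤deg , reciprocated)
      where
      k≤deg+1 : k ≤ deg i + 1
      k≤deg+1 = ≤-trans (m≤m+n k _) (≤-trans (tds⇒local tds ij) (+-monoʳ-≤ (deg i) (⟦⟧≤1 (∈S (j , i)))))

      member : ∃ λ j' → T (∈S (i , j'))
      member = count-witness (λ j' → ∈S (i , j')) (+-cancelʳ-≤ 1 1 (deg i) (≤-trans 1<k k≤deg+1))

      k≤deg : k ≤ deg i
      k≤deg = let j' , i,j'∈S = member in
        +-cancelʳ-≤ 1 k (deg i) (≤-trans (dominated-member i,j'∈S) (+-monoʳ-≤ (deg i) (⟦⟧≤1 (∈S (j' , i)))))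

      reciprocated : Reciprocated i
      reciprocated j' i,j'∈S = ⟦⟧-pos (+-cancelˡ-≤ k 1 ⟦ ∈S (j' , i) ⟧
        (≤-trans (dominated-member i,j'∈S) (+-monoˡ-≤ ⟦ ∈S (j' , i) ⟧ (≮⇒≥ k≮deg))))

-- A k-regular circulant pattern on Fin ℓ

module Rotation (m : ℕ) where

  rotate : Fin (suc m) → Fin (suc m)
  rotate c = fromℕ< (m%n<n (suc (toℕ c)) (suc m))

  toℕ-rotate : ∀ c → toℕ (rotate c) ≡ suc (toℕ c) % suc m
  toℕ-rotate c = toℕ-fromℕ< (m%n<n (suc (toℕ c)) (suc m))

  rotate-inject₁ : ∀ (x : Fin m) → rotate (inject₁ x) ≡ suc x
  rotate-inject₁ x = toℕ-injective (begin
    toℕ (rotate (inject₁ x))        ≡⟨ toℕ-rotate (inject₁ x) ⟩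
    suc (toℕ (inject₁ x)) % suc m   ≡⟨ cong (λ y → suc y % suc m) (toℕ-inject₁ x) ⟩
    suc (toℕ x) % suc m             ≡⟨ m≤n⇒m%n≡m (toℕ<n x) ⟩
    suc (toℕ x)                     ∎)
    where open ≡-Reasoning

  rotate-last : rotate (fromℕ m) ≡ zero
  rotate-last = toℕ-injective (begin
    toℕ (rotate (fromℕ m))      ≡⟨ toℕ-rotate (fromℕ m) ⟩
    suc (toℕ (fromℕ m)) % suc m ≡⟨ cong (λ y → suc y % suc m) (toℕ-fromℕ m) ⟩
    suc m % suc m               ≡⟨ n%n≡0 (suc m) ⟩
    0                           ∎)
    where open ≡-Reasoning

  sum-rotate : (f : Fin (suc m) → ℕ) → sum (f ∘ rotate) ≡ sum f
  sum-rotate f = begin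
    sum (f ∘ rotate)                                   ≡⟨ sum-init-last (f ∘ rotate) ⟩
    sum (f ∘ rotate ∘ inject₁) + f (rotate (fromℕ m))  ≡⟨ cong₂ _+_ (sum-cong-≗ (cong f ∘ rotate-inject₁))
                                                                    (cong f rotate-last) ⟩
    sum (f ∘ suc) + f zero                             ≡⟨ +-comm (sum (f ∘ suc)) (f zero) ⟩
    sum f                                              ∎
    where open ≡-Reasoning

%-absorbʳ : ∀ x y d .{{_ : NonZero d}} → (x + y % d) % d ≡ (x + y) % d
%-absorbʳ x y d = begin
  (x + y % d) % d            ≡⟨ %-distribˡ-+ x (y % d) d ⟩
  (x % d + y % d % d) % d    ≡⟨ cong (λ z → (x % d + z) % d) (m%n%n≡m%n y d) ⟩
  (x % d + y % d) % d        ≡⟨ %-distribˡ-+ x y d ⟨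
  (x + y) % d                ∎
  where open ≡-Reasoning

circulant : ∀ {m} → ℕ → Fin (suc m) → Fin (suc m) → Bool
circulant {m} k a c = ((toℕ a + toℕ c) % suc m) <ᵇ k

-- The relation is symmetric, so circulant choices can be reciprocated.
circulant-sym : ∀ {m} k (a c : Fin (suc m)) → circulant k a c ≡ circulant k c a
circulant-sym {m} k a c = cong (λ z → (z % suc m) <ᵇ k) (+-comm (toℕ a) (toℕ c))

-- For k ≤ ℓ every element is related to exactly k elements: the number of
-- c with (x + c) mod ℓ < k does not depend on the shift x, by rotation
-- invariance, and for x = 0 it is k.
circulant-regular : ∀ {m} k → k ≤ suc m → ∀ a → count (circulant k a) ≡ k
circulant-regular {m} k k≤ℓ a = trans (shift-invariant (toℕ a)) unshifted
  where
  open Rotation m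

  shifted : ℕ → Fin (suc m) → ℕ
  shifted x c = ⟦ ((x + toℕ c) % suc m) <ᵇ k ⟧

  shift-rotate : ∀ x c → shifted x (rotate c) ≡ shifted (suc x) c
  shift-rotate x c = cong (λ z → ⟦ z <ᵇ k ⟧) (begin
    (x + toℕ (rotate c)) % suc m         ≡⟨ cong (λ y → (x + y) % suc m) (toℕ-rotate c) ⟩
    (x + suc (toℕ c) % suc m) % suc m    ≡⟨ %-absorbʳ x (suc (toℕ c)) (suc m) ⟩
    (x + suc (toℕ c)) % suc m            ≡⟨ cong (_% suc m) (+-suc x (toℕ c)) ⟩
    (suc x + toℕ c) % suc m              ∎)
    where open ≡-Reasoning

  shift-invariant : ∀ x → sum (shifted x) ≡ sum (shifted 0)
  shift-invariant zero    = refl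
  shift-invariant (suc x) =
    trans (trans (sym (sum-cong-≗ (shift-rotate x))) (sum-rotate (shifted x))) (shift-invariant x)

  unshifted : sum (shifted 0) ≡ k
  unshifted = trans (sum-cong-≗ {suc m} (λ c → cong (λ z → ⟦ z <ᵇ k ⟧) (m<n⇒m%n≡m {n = suc m} (toℕ<n c)))) (count-<ᵇ (suc m) k k≤ℓ)

-- The complete bipartite graph K_{ℓ,m}

-- Vertices of Fin (ℓ + m) are split into the side A (the first ℓ) and the side B.
crossing : ∀ {ℓ m} → Fin ℓ ⊎ Fin m → Fin ℓ ⊎ Fin m → Bool
crossing (inj₁ _) (inj₂ _) = true
crossing (inj₂ _) (inj₁ _) = true
crossing _        _        = false

crossing-sym : ∀ {ℓ m} (x y : Fin ℓ ⊎ Fin m) → crossing x y ≡ crossing y x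
crossing-sym (inj₁ _) (inj₁ _) = refl
crossing-sym (inj₁ _) (inj₂ _) = refl
crossing-sym (inj₂ _) (inj₁ _) = refl
crossing-sym (inj₂ _) (inj₂ _) = refl

crossing-irrefl : ∀ {ℓ m} (x : Fin ℓ ⊎ Fin m) → crossing x x ≡ false
crossing-irrefl (inj₁ _) = refl
crossing-irrefl (inj₂ _) = refl

module CompleteBipartite (ℓ m : ℕ) where

  G : Graph (ℓ + m)
  G = record
    { adj    = λ i j → crossing (splitAt ℓ i) (splitAt ℓ j)
    ; sym    = λ i j → crossing-sym (splitAt ℓ i) (splitAt ℓ j)
    ; irrefl = λ i → crossing-irrefl (splitAt ℓ i)
    }

  A : Fin ℓ → Fin (ℓ + m)
  A a = a ↑ˡ m

  B : Fin m → Fin (ℓ + m)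
  B b = ℓ ↑ʳ b

  AA-nonadjacent : ∀ a a' → adj G (A a) (A a') ≡ false
  AA-nonadjacent a a' rewrite splitAt-↑ˡ ℓ a m | splitAt-↑ˡ ℓ a' m = refl

  BB-nonadjacent : ∀ b b' → adj G (B b) (B b') ≡ false
  BB-nonadjacent b b' rewrite splitAt-↑ʳ ℓ m b | splitAt-↑ʳ ℓ m b' = refl

  AB-adjacent : ∀ a b → T (adj G (A a) (B b))
  AB-adjacent a b rewrite splitAt-↑ˡ ℓ a m | splitAt-↑ʳ ℓ m b = tt

  BA-adjacent : ∀ b a → T (adj G (B b) (A a))
  BA-adjacent b a rewrite splitAt-↑ˡ ℓ a m | splitAt-↑ʳ ℓ m b = tt

  no-isolated : Fin ℓ → Fin m → NoIsolated G
  no-isolated a₀ b₀ = ↑-elim _ (λ a → B b₀ , AB-adjacent a b₀) (λ b → A a₀ , BA-adjacent b a₀)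

  module Sides (S : ISubset G) where
    open Degrees G S

    ∉S : ∀ {i j} → adj G i j ≡ false → ¬ T (∈S (i , j))
    ∉S {i} {j} nonadjacent i,j∈S = subst T nonadjacent (proj₂ S (i , j) i,j∈S)

    ⟦∉S⟧ : ∀ {i j} → adj G i j ≡ false → ⟦ ∈S (i , j) ⟧ ≡ 0
    ⟦∉S⟧ {i} {j} nonadjacent with ∈S (i , j) in i,j∈S
    ... | false = refl
    ... | true  = contradiction (subst T (sym i,j∈S) tt) (∉S nonadjacent)

    deg-A : ∀ a → deg (A a) ≡ count (λ b → ∈S (A a , B b))
    deg-A a = trans (sum-↑ {ℓ} {m} (λ j → ⟦ ∈S (A a , j) ⟧))
      (cong (_+ count (λ b → ∈S (A a , B b))) (sum-zero _ (λ a' → ⟦∉S⟧ (AA-nonadjacent a a'))))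

    deg-B : ∀ b → deg (B b) ≡ count (λ a → ∈S (B b , A a))
    deg-B b = trans (sum-↑ {ℓ} {m} (λ j → ⟦ ∈S (B b , j) ⟧))
      (trans (cong (count (λ a → ∈S (B b , A a)) +_) (sum-zero _ (λ b' → ⟦∉S⟧ (BB-nonadjacent b b'))))
             (+-identityʳ _))

    indeg-B : ∀ b → indeg (B b) ≡ count (λ a → ∈S (A a , B b))
    indeg-B b = trans (sum-↑ {ℓ} {m} (λ j → ⟦ ∈S (j , B b) ⟧))
      (trans (cong (count (λ a → ∈S (A a , B b)) +_) (sum-zero _ (λ b' → ⟦∉S⟧ (BB-nonadjacent b' b))))
             (+-identityʳ _))

    card-sides : card G S ≡ sum (deg ∘ A) + sum (deg ∘ B)
    card-sides = trans card≡∑deg (sum-↑ {ℓ} {m} deg)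

-- The numerical core of the lower bound: from m·k(k+1) ≤ kY + X and ℓk ≤ X
-- (k ≥ 1) follows (ℓ + m)(k + 1) − 2ℓ ≤ X + Y; multiply the goal by k and
-- use k(X + Y) = (kY + X) + (k − 1)X.
lower-bound-arithmetic : ∀ {k} ℓ m X Y → 1 ≤ k →
  m * (k * suc k) ≤ k * Y + X → ℓ * k ≤ X → (ℓ + m) * (k + 1) ∸ 2 * ℓ ≤ X + Y
lower-bound-arithmetic {suc k'} ℓ m X Y _ mk[k+1]≤kY+X ℓk≤X =
  subst (_≤ X + Y) (sym target-value) (*-cancelˡ-≤ (suc k') (begin
    (1 + k') * (m * (2 + k') + k' * ℓ)              ≡⟨ scaled-target ℓ m k' ⟩
    m * ((1 + k') * (2 + k')) + k' * (ℓ * (1 + k')) ≤⟨ +-mono-≤ mk[k+1]≤kY+X (*-monoʳ-≤ k' ℓk≤X) ⟩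
    ((1 + k') * Y + X) + k' * X                     ≡⟨ scaled-sum X Y k' ⟨
    (1 + k') * (X + Y)                              ∎))
  where
  open ≤-Reasoning
  value : ∀ ℓ m k' → (ℓ + m) * ((1 + k') + 1) ≡ (m * (2 + k') + k' * ℓ) + 2 * ℓ
  value = solve-∀
  scaled-target : ∀ ℓ m k' → (1 + k') * (m * (2 + k') + k' * ℓ) ≡ m * ((1 + k') * (2 + k')) + k' * (ℓ * (1 + k'))
  scaled-target = solve-∀
  scaled-sum : ∀ X Y k' → (1 + k') * (X + Y) ≡ ((1 + k') * Y + X) + k' * X
  scaled-sum = solve-∀
  target-value : (ℓ + m) * (suc k' + 1) ∸ 2 * ℓ ≡ m * (2 + k') + k' * ℓ
  target-value = trans (cong (_∸ 2 * ℓ) (value ℓ m k')) (m+n∸n≡m (m * (2 + k') + k' * ℓ) (2 * ℓ))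

-- All vertices are served; side A contributes X ≥ ℓk, and summing
-- served⇒bound over side B gives m·k(k+1) ≤ kY + X, as the in-degrees on
-- B add up to the out-degrees on A.
lower-bound : ∀ {ℓ m k} → 1 < k → Fin ℓ → Fin m → (S : ISubset (CompleteBipartite.G ℓ m)) →
  IsKTupleTDS (CompleteBipartite.G ℓ m) k S → (ℓ + m) * (k + 1) ∸ 2 * ℓ ≤ card (CompleteBipartite.G ℓ m) S
lower-bound {ℓ} {m} {k} 1<k a₀ b₀ S tds =
  subst ((ℓ + m) * (k + 1) ∸ 2 * ℓ ≤_) (sym card-sides)
        (lower-bound-arithmetic ℓ m X Y (<⇒≤ 1<k) B-bound A-bound)
  where
  open CompleteBipartite ℓ m
  open Degrees G S
  open Sides S
  open Domination G S k

  X Y : ℕ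
  X = sum (deg ∘ A)
  Y = sum (deg ∘ B)

  A-bound : ℓ * k ≤ X
  A-bound = subst (_≤ X) (sum-const {ℓ} k) (sum-mono (λ a → served⇒k≤deg (tds⇒served tds 1<k (AB-adjacent a b₀))))

  in-degrees-B : sum (indeg ∘ B) ≡ X
  in-degrees-B = begin
    sum (indeg ∘ B)                                  ≡⟨ sum-cong-≗ indeg-B ⟩
    sum (λ b → sum (λ a → ⟦ ∈S (A a , B b) ⟧))       ≡⟨ ∑-comm (λ b a → ⟦ ∈S (A a , B b) ⟧) ⟩
    sum (λ a → count (λ b → ∈S (A a , B b)))         ≡⟨ sum-cong-≗ deg-A ⟨
    X                                                ∎
    where open ≡-Reasoning

  B-bound : m * (k * suc k) ≤ k * Y + X
  B-bound = begin
    m * (k * suc k)                                  ≡⟨ sum-const {m} (k * suc k) ⟨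
    sum {m} (λ _ → k * suc k)                        ≤⟨ sum-mono (λ b → served⇒bound (tds⇒served tds 1<k (BA-adjacent b a₀))) ⟩
    sum (λ b → k * deg (B b) + indeg (B b))          ≡⟨ ∑-distrib-+ (λ b → k * deg (B b)) (indeg ∘ B) ⟩
    sum (λ b → k * deg (B b)) + sum (indeg ∘ B)      ≡⟨ cong₂ _+_ (sum-*ˡ k (deg ∘ B)) in-degrees-B ⟩
    k * Y + X                                        ∎
    where open ≤-Reasoning

-- Side B consists
-- of ℓ core vertices and p extra ones.  An A-vertex a and a core vertex c
-- choose each other (x_a x_c, x_c x_a ∈ S₀) when circulant k a c, and an
-- extra vertex chooses the first k + 1 vertices of A.  Then A-vertices and
-- core vertices have k reciprocated choices and extra vertices k + 1.
module Construction (L p k : ℕ) (k<ℓ : k < suc L) where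
  ℓ : ℕ
  ℓ = suc L

  open CompleteBipartite ℓ (ℓ + p)

  core : Fin ℓ → Fin (ℓ + p)
  core c = c ↑ˡ p

  extra : Fin p → Fin (ℓ + p)
  extra e = ℓ ↑ʳ e

  chosen : Fin ℓ ⊎ Fin (ℓ + p) → Fin ℓ ⊎ Fin (ℓ + p) → Bool
  chosen (inj₁ a) (inj₂ b) = [ circulant k a , (λ _ → false) ]′ (splitAt ℓ b)
  chosen (inj₂ b) (inj₁ a) = [ (λ c → circulant k c a) , (λ _ → toℕ a <ᵇ suc k) ]′ (splitAt ℓ b)
  chosen _        _        = false

  chosen⇒crossing : ∀ x y → T (chosen x y) → T (crossing x y)
  chosen⇒crossing (inj₁ _) (inj₂ _) _ = tt
  chosen⇒crossing (inj₂ _) (inj₁ _) _ = tt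

  S₀ : ISubset G
  S₀ = (λ (i , j) → chosen (splitAt ℓ i) (splitAt ℓ j))
     , (λ (i , j) → chosen⇒crossing (splitAt ℓ i) (splitAt ℓ j))

  open Degrees G S₀
  open Sides S₀
  open Domination G S₀ k

  A-core : ∀ a c → ∈S (A a , B (core c)) ≡ circulant k a c
  A-core a c rewrite splitAt-↑ˡ ℓ a (ℓ + p) | splitAt-↑ʳ ℓ (ℓ + p) (core c) | splitAt-↑ˡ ℓ c p = refl

  A-extra : ∀ a e → ∈S (A a , B (extra e)) ≡ false
  A-extra a e rewrite splitAt-↑ˡ ℓ a (ℓ + p) | splitAt-↑ʳ ℓ (ℓ + p) (extra e) | splitAt-↑ʳ ℓ p e = refl

  core-A : ∀ c a → ∈S (B (core c) , A a) ≡ circulant k c a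
  core-A c a rewrite splitAt-↑ˡ ℓ a (ℓ + p) | splitAt-↑ʳ ℓ (ℓ + p) (core c) | splitAt-↑ˡ ℓ c p = refl

  extra-A : ∀ e a → ∈S (B (extra e) , A a) ≡ (toℕ a <ᵇ suc k)
  extra-A e a rewrite splitAt-↑ˡ ℓ a (ℓ + p) | splitAt-↑ʳ ℓ (ℓ + p) (extra e) | splitAt-↑ʳ ℓ p e = refl

  deg-A₀ : ∀ a → deg (A a) ≡ k
  deg-A₀ a = begin
    deg (A a)                                                        ≡⟨ deg-A a ⟩
    count (λ b → ∈S (A a , B b))                                     ≡⟨ sum-↑ {ℓ} {p} (λ b → ⟦ ∈S (A a , B b) ⟧) ⟩
    count (λ c → ∈S (A a , B (core c))) + count (λ e → ∈S (A a , B (extra e)))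
                                                                     ≡⟨ cong₂ _+_ (sum-cong-≗ (cong ⟦_⟧ ∘ A-core a))
                                                                                  (sum-zero _ (cong ⟦_⟧ ∘ A-extra a)) ⟩
    count (circulant k a) + 0                                        ≡⟨ +-identityʳ _ ⟩
    count (circulant k a)                                            ≡⟨ circulant-regular k (<⇒≤ k<ℓ) a ⟩
    k                                                                ∎
    where open ≡-Reasoning

  deg-core : ∀ c → deg (B (core c)) ≡ k
  deg-core c = trans (deg-B (core c)) (trans (sum-cong-≗ (cong ⟦_⟧ ∘ core-A c)) (circulant-regular k (<⇒≤ k<ℓ) c))

  deg-extra : ∀ e → deg (B (extra e)) ≡ suc k
  deg-extra e = trans (deg-B (extra e)) (trans (sum-cong-≗ (cong ⟦_⟧ ∘ extra-A e)) (count-<ᵇ ℓ (suc k) k<ℓ))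

  -- Every vertex is served: choices between A and the core are mutual.
  served-A : ∀ a → Served (A a)
  served-A a = inj₂ (≤-reflexive (sym (deg-A₀ a)) , ↑-elim _ from-A from-B)
    where
    from-A : ∀ a' → T (∈S (A a , A a')) → T (∈S (A a' , A a))
    from-A a' a,a'∈S = contradiction a,a'∈S (∉S {A a} {A a'} (AA-nonadjacent a a'))
    from-core : ∀ c → T (∈S (A a , B (core c))) → T (∈S (B (core c) , A a))
    from-core c chosen-ac = subst T (sym (trans (core-A c a) (circulant-sym k c a))) (subst T (A-core a c) chosen-ac)
    from-extra : ∀ e → T (∈S (A a , B (extra e))) → T (∈S (B (extra e) , A a))
    from-extra e chosen-ae = contradiction (subst T (A-extra a e) chosen-ae) λ ()
    from-B : ∀ b → T (∈S (A a , B b)) → T (∈S (B b , A a))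
    from-B = ↑-elim _ from-core from-extra

  served-core : ∀ c → Served (B (core c))
  served-core c = inj₂ (≤-reflexive (sym (deg-core c)) , ↑-elim _ to-A to-B)
    where
    to-A : ∀ a → T (∈S (B (core c) , A a)) → T (∈S (A a , B (core c)))
    to-A a chosen-ca = subst T (sym (trans (A-core a c) (circulant-sym k a c))) (subst T (core-A c a) chosen-ca)
    to-B : ∀ b → T (∈S (B (core c) , B b)) → T (∈S (B b , B (core c)))
    to-B b c,b∈S = contradiction c,b∈S (∉S {B (core c)} {B b} (BB-nonadjacent (core c) b))

  served-extra : ∀ e → Served (B (extra e))
  served-extra e = inj₁ (≤-reflexive (sym (deg-extra e)))

  tds₀ : IsKTupleTDS G k S₀
  tds₀ = served⇒tds (↑-elim _ served-A (↑-elim _ served-core served-extra))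

  card₀ : card G S₀ ≡ ℓ * k + (ℓ * k + p * suc k)
  card₀ = begin
    card G S₀                                                     ≡⟨ card-sides ⟩
    sum (deg ∘ A) + sum (deg ∘ B)                                 ≡⟨ cong (sum (deg ∘ A) +_) (sum-↑ {ℓ} {p} (deg ∘ B)) ⟩
    sum (deg ∘ A) + (sum (deg ∘ B ∘ core) + sum (deg ∘ B ∘ extra)) ≡⟨ cong₂ _+_ (sum-cong-≗ deg-A₀)
                                                                       (cong₂ _+_ (sum-cong-≗ deg-core) (sum-cong-≗ deg-extra)) ⟩
    sum {ℓ} (λ _ → k) + (sum {ℓ} (λ _ → k) + sum {p} (λ _ → suc k)) ≡⟨ cong₂ _+_ (sum-const {ℓ} k)
                                                                       (cong₂ _+_ (sum-const {ℓ} k) (sum-const {p} (suc k))) ⟩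
    ℓ * k + (ℓ * k + p * suc k)                                   ∎
    where open ≡-Reasoning

construction-size : ∀ ℓ p k → ℓ * k + (ℓ * k + p * suc k) ≡ (ℓ + (ℓ + p)) * (k + 1) ∸ 2 * ℓ
construction-size ℓ p k = sym (trans (cong (_∸ 2 * ℓ) (expand ℓ p k)) (m+n∸n≡m (ℓ * k + (ℓ * k + p * (1 + k))) (2 * ℓ)))
  where
  expand : ∀ ℓ p k → (ℓ + (ℓ + p)) * (k + 1) ≡ (ℓ * k + (ℓ * k + p * (1 + k))) + 2 * ℓ
  expand = solve-∀

bipartite-optimum : ∀ L p k → 1 < k → k < suc L →
  GammaKT-Inflated≡ (CompleteBipartite.G (suc L) (suc L + p)) k ((suc L + (suc L + p)) * (k + 1) ∸ 2 * suc L)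
bipartite-optimum L p k 1<k k<ℓ =
  (S₀ , tds₀ , trans card₀ (construction-size (suc L) p k)) , lower-bound 1<k zero zero
  where open Construction L p k k<ℓ

-- Take G = K_{ℓ,ℓ+p} with p = n − 2ℓ ≥ 0, whose order is n, and apply
-- bipartite-optimum; ℓ = 0 is excluded by k < ℓ.
theorem4p5 : ∀ (n k ℓ : ℕ) → 2 ≤ k → k < ℓ → ℓ ≤ n / 2 →
    Σ (Graph n) λ G → NoIsolated G × GammaKT-Inflated≡ G k (n * (k + 1) ∸ 2 * ℓ)
theorem4p5 n k zero    _   ()  _
theorem4p5 n k (suc L) 2≤k k<ℓ ℓ≤n/2 =
  subst (λ n' → Σ (Graph n') λ G → NoIsolated G × GammaKT-Inflated≡ G k (n' * (k + 1) ∸ 2 * ℓ)) order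
        (G , no-isolated zero zero , bipartite-optimum L p k 2≤k k<ℓ)
  where
  ℓ p : ℕ
  ℓ = suc L
  p = n ∸ 2 * ℓ
  open CompleteBipartite ℓ (ℓ + p)

  2ℓ≤n : 2 * ℓ ≤ n
  2ℓ≤n = subst (_≤ n) (*-comm ℓ 2) (≤-trans (*-monoˡ-≤ 2 ℓ≤n/2) (m/n*n≤m n 2))

  order : ℓ + (ℓ + p) ≡ n
  order = trans (sym (+-assoc ℓ ℓ p)) (trans (cong (λ x → ℓ + x + p) (sym (+-identityʳ ℓ))) (m+[n∸m]≡n 2ℓ≤n))
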